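{- Let $S$ be a finite set of intervals and $I_i\in S$. Then for every $k\ge 1$ with $\textsc{LC}^k(I_i)\neq\perp$, the interval $\textsc{LC}^k(I_i)$ is active in $S$; that is, the greedy algorithm for interval scheduling resumed from $I_i$ chooses (after $I_i$) only active intervals of $S$.
   Context: Intervals are pairs $(s,f)$ of reals with $s<f$, with pairwise distinct endpoints; two intervals are compatible if disjoint. For $I_i=(s_i,f_i)$, $\textsc{LC}(I_i)$ is the interval $(s_{i'},f_{i'})\in S$ with the smallest $f_{i'}$ such that $s_{i'}\ge f_i$, and $\perp$ if none exists. Resuming the greedy algorithm from $I_i$ means selecting $I_i,\textsc{LC}(I_i),\textsc{LC}^2(I_i),\dots$ until $\perp$. An interval $(s_i,f_i)$ of a collection $C$ is active if there is no other $(s_{i'},f_{i'})\in C$ with $s_i\le s_{i'}\le f_{i'}\le f_i$; otherwise it is inactive.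
   Formalization: The endpoints of the intervals in S are rational numbers rather than reals. -}

module Defs where

open import Data.Nat using (ℕ; zero; suc)
open import Data.Rational using (ℚ; _≤_; _<_)
open import Data.List using (List; []; _∷_; concatMap)
open import Data.List.Membership.Propositional using (_∈_)
open import Data.List.Relation.Unary.All using (All)
open import Data.List.Relation.Unary.Unique.Propositional using (Unique)
open import Data.Empty using (⊥)
open import Data.Product using (_×_)
open import Relation.Binary.PropositionalEquality using (_≡_; _≢_)

-- An interval (s , f); well-formedness s < f is imposed on the collection.
record Interval : Set where
  constructor ⟨_,_⟩
  field
    s : ℚ
    f : ℚ
open Interval public

endpoints : Interval → List ℚ
endpoints I = s I ∷ f I ∷ []

WellFormed : List Interval → Set
WellFormed S = All (λ I → s I < f I) S × Unique (concatMap endpoints S)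

IsLC : List Interval → Interval → Interval → Set
IsLC S I J = J ∈ S × f I ≤ s J × (∀ J' → J' ∈ S → f I ≤ s J' → f J ≤ f J')

-- LC^k(I) = J (in particular LC^k(I) ≠ ⊥).
data LCPow (S : List Interval) (I : Interval) : ℕ → Interval → Set where
  lc-zero : LCPow S I zero I
  lc-suc  : ∀ {k K J} → LCPow S I k K → IsLC S K J → LCPow S I (suc k) J

Active : List Interval → Interval → Set
Active C I = ∀ J → J ∈ C → J ≢ I → s I ≤ s J → s J ≤ f J → f J ≤ f I → ⊥

{-# OPTIONS --safe #-}
module Submission where

-- Only the last step LC^(k+1)(I) = LC(K) matters: any image J = LC(K) is
-- active. An interval J' nested in J also starts after f K, so the minimality
-- of f J gives f J ≤ f J' ≤ f J; as right endpoints are distinct, J' = J.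

open import Defs
open import Data.Nat using (ℕ; suc)
open import Data.List using (List; _∷_; concatMap)
open import Data.List.Membership.Propositional using (_∈_)
open import Data.List.Relation.Unary.Any using (here; there)
open import Data.List.Relation.Unary.All using (lookup)
open import Data.List.Relation.Unary.AllPairs using (_∷_)
open import Data.List.Relation.Unary.Unique.Propositional using (Unique)
open import Data.Rational.Properties using (≤-antisym; ≤-trans)
open import Data.Empty using (⊥-elim)
open import Data.Product using (_,_)
open import Relation.Binary.PropositionalEquality using (_≡_; refl; sym)

f∈endpoints : ∀ {J} S → J ∈ S → f J ∈ concatMap endpoints S
f∈endpoints (_ ∷ _) (here refl)  = there (here refl)
f∈endpoints (_ ∷ S) (there J∈S) = there (there (f∈endpoints S J∈S))

f-injective : ∀ S → Unique (concatMap endpoints S) →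
              ∀ {J J'} → J ∈ S → J' ∈ S → f J ≡ f J' → J ≡ J'
f-injective (_ ∷ _) _                (here refl)  (here refl)   _  = refl
f-injective (_ ∷ S) (_ ∷ (f∉S ∷ _)) (here refl)  (there J'∈S) eq =
  ⊥-elim (lookup f∉S (f∈endpoints S J'∈S) eq)
f-injective (_ ∷ S) (_ ∷ (f∉S ∷ _)) (there J∈S) (here refl)   eq =
  ⊥-elim (lookup f∉S (f∈endpoints S J∈S) (sym eq))
f-injective (_ ∷ S) (_ ∷ (_ ∷ distinct)) (there J∈S) (there J'∈S) eq =
  f-injective S distinct J∈S J'∈S eq

IsLC⇒Active : ∀ S K {J} → Unique (concatMap endpoints S) → IsLC S K J → Active S J
IsLC⇒Active S _ distinct (J∈S , fK≤sJ , least) J' J'∈S J'≢J sJ≤sJ' _ fJ'≤fJ =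
  J'≢J (f-injective S distinct J'∈S J∈S (≤-antisym fJ'≤fJ (least J' J'∈S (≤-trans fK≤sJ sJ≤sJ'))))

lemma5 : (S : List Interval) → WellFormed S → (I : Interval) → I ∈ S →
           (k : ℕ) → (J : Interval) → LCPow S I (suc k) J → Active S J
lemma5 S (_ , distinct) I _ k J (lc-suc {K = K} _ J=LC[K]) = IsLC⇒Active S K distinct J=LC[K]
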